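{- Let $G$ be a finite simple graph with at least one edge such that $\chi(G) > \frac{\Delta(G)}{2} + 1$. Then ${\rm vs}_{\chi}(G) = {\rm es}_{\chi}(G)$.
   Context: $\chi(G)$ is the chromatic number and $\Delta(G)$ the maximum degree of $G$. The chromatic vertex stability number ${\rm vs}_{\chi}(G)$ is the minimum number of vertices of $G$ whose deletion results in a graph $H$ with $\chi(H) = \chi(G)-1$. The chromatic edge stability number ${\rm es}_{\chi}(G)$ is the minimum number of edges of $G$ whose deletion results in a graph $H$ with $\chi(H) = \chi(G)-1$. -}

module Defs where

open import Data.Bool using (Bool; true; false; _∧_; _∨_; not; if_then_else_)
open import Data.Bool.Properties using (∨-comm)
open import Data.Nat using (ℕ; zero; suc; _+_; _∸_; _⊔_; _≤_; _<ᵇ_)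
open import Data.Fin using (Fin; toℕ)
open import Data.Fin.Subset using (Subset; _∈_; ∁; ⊤; ∣_∣)
open import Data.List using (List; map; foldr; allFin)
open import Data.Nat.ListAction using (sum)
open import Data.Product using (Σ; ∃; _×_; _,_)
open import Relation.Binary.PropositionalEquality using (_≡_; _≢_; cong; cong₂; refl)

record Graph (n : ℕ) : Set where
  field
    adj    : Fin n → Fin n → Bool
    sym    : ∀ u v → adj u v ≡ adj v u
    irrefl : ∀ v → adj v v ≡ false
open Graph public

count : ∀ {n} → (Fin n → Bool) → ℕ
count {n} p = sum (map (λ u → if p u then 1 else 0) (allFin n))

degree : ∀ {n} → Graph n → Fin n → ℕ
degree G v = count (adj G v)

maxDegree : ∀ {n} → Graph n → ℕ
maxDegree {n} G = foldr _⊔_ 0 (map (degree G) (allFin n))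

HasEdge : ∀ {n} → Graph n → Set
HasEdge G = ∃ λ u → ∃ λ v → adj G u v ≡ true

Colorable : ∀ {n} → Graph n → Subset n → ℕ → Set
Colorable {n} G W k =
  Σ (Fin n → Fin k) λ c →
    ∀ u v → u ∈ W → v ∈ W → adj G u v ≡ true → c u ≢ c v

IsChromaticNumberOn : ∀ {n} → Graph n → Subset n → ℕ → Set
IsChromaticNumberOn G W k = Colorable G W k × (∀ m → Colorable G W m → k ≤ m)

IsChromaticNumber : ∀ {n} → Graph n → ℕ → Set
IsChromaticNumber G k = IsChromaticNumberOn G ⊤ k

-- G - S : deleting the vertex set S leaves the induced subgraph G[∁ S].
-- Deleting S lowers the chromatic number by one: χ(G - S) = χ(G) - 1.
VertexDeletionDrops : ∀ {n} → Graph n → Subset n → Set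
VertexDeletionDrops G S =
  ∀ k → IsChromaticNumber G k → IsChromaticNumberOn G (∁ S) (k ∸ 1)

IsVertexStability : ∀ {n} → Graph n → ℕ → Set
IsVertexStability G s =
  (∃ λ S → ∣ S ∣ ≡ s × VertexDeletionDrops G S)
  × (∀ S → VertexDeletionDrops G S → s ≤ ∣ S ∣)

record EdgeSet {n : ℕ} (G : Graph n) : Set where
  field
    mem    : Fin n → Fin n → Bool
    memSym : ∀ u v → mem u v ≡ mem v u
    sub    : ∀ u v → mem u v ≡ true → adj G u v ≡ true
open EdgeSet public

-- number of edges in an edge set (each unordered pair {u,v} counted once, u < v)
edgeCount : ∀ {n} {G : Graph n} → EdgeSet G → ℕ
edgeCount {n} F =
  sum (map (λ u → count (λ v → (toℕ u <ᵇ toℕ v) ∧ mem F u v)) (allFin n))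

deleteEdges : ∀ {n} (G : Graph n) → EdgeSet G → Graph n
deleteEdges G F = record
  { adj    = λ u v → adj G u v ∧ not (mem F u v)
  ; sym    = λ u v → cong₂ (λ a b → a ∧ not b) (sym G u v) (memSym F u v)
  ; irrefl = λ v → cong (λ a → a ∧ not (mem F v v)) (irrefl G v)
  }

EdgeDeletionDrops : ∀ {n} (G : Graph n) → EdgeSet G → Set
EdgeDeletionDrops G F =
  ∀ k → IsChromaticNumber G k → IsChromaticNumber (deleteEdges G F) (k ∸ 1)

IsEdgeStability : ∀ {n} → Graph n → ℕ → Set
IsEdgeStability G e =
  (∃ λ F → edgeCount {G = G} F ≡ e × EdgeDeletionDrops G F)
  × (∀ F → EdgeDeletionDrops G F → e ≤ edgeCount {G = G} F)

module Submission where

-- Let χ(G) = k + 1. If deleting some vertices (or edges) leaves G k-colorable, then putting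
-- them back one vertex index at a time raises the chromatic number by at most one per step,
-- so some subset of them lowers χ by exactly one. It therefore suffices to trade a deletion
-- set of one kind for one of the other kind that is no larger and still leaves G k-colorable.
--
-- Edges to vertices: delete the smaller endpoint of every deleted edge.
--
-- Vertices to edges, where Δ < 2k is used: extend a k-coloring of G - S to the vertices x of S
-- one at a time. The fewer than 2k neighbours of x cannot use every color twice, so x gets a
-- color it shares with at most one neighbour; deleting that one edge for each x of S leaves
-- the coloring proper.

open import Defs hiding (sym)
open import Data.Bool using (Bool; true; false; _∧_; _∨_; if_then_else_; T)
import Data.Bool as Bool
open import Data.Bool.Properties using (T-≡; ∧-comm; ∨-comm; ¬-not)
open import Data.Fin using (Fin; zero; suc; toℕ; _≟_; fromℕ; inject₁; inject≤; finToFun; funToFin)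
open import Data.Fin.Properties
  using (toℕ<n; any?; all?; toℕ-injective; fromℕ≢inject₁; inject₁-injective; inject≤-injective; finToFun-funToFin)
open import Data.Fin.Subset using (Subset; ∣_∣; _∈_; _∉_; ∁; ⊤; _∩_)
open import Data.Fin.Subset.Properties
  using (_∈?_; ∈⊤; x∈p∩q⁺; x∈p∩q⁻; x∉p⇒x∈∁p; x∈∁p⇒x∉p; ∣p∩q∣≤∣p∣)
open import Data.List using (foldr; map; tabulate)
open import Data.Maybe using (Maybe; just; nothing; is-just)
open import Data.Nat using (ℕ; zero; suc; _+_; _*_; _∸_; _^_; _⊔_; _≤_; _<_; _<ᵇ_; _≤ᵇ_; z≤n; s≤s; _≤?_)
import Data.Nat as ℕ
import Data.Nat.ListAction as ListAction
open import Data.Nat.Properties hiding (_≟_)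
open import Algebra.Properties.CommutativeMonoid.Sum +-0-commutativeMonoid
  using (sum; sum-syntax; sum-cong-≗; sum-replicate-zero; ∑-distrib-+; ∑-comm)
open import Data.Product using (∃; _×_; _,_; proj₁; proj₂)
import Data.Product as Product
open import Data.Sum using (_⊎_; inj₁; inj₂; [_,_])
import Data.Sum as Sum
open import Data.Vec using (lookup; _∷_; [])
import Data.Vec as Vec
open import Data.Vec.Properties using (lookup∘tabulate; []=⇒lookup; lookup⇒[]=)
open import Function using (_∘_; id)
open import Function.Bundles using (Equivalence)
open import Relation.Binary using (tri<; tri≈; tri>)
open import Relation.Binary.PropositionalEquality
  using (_≡_; _≢_; refl; sym; trans; cong; cong₂; subst; module ≡-Reasoning)
open import Relation.Nullary using (¬_; Dec; yes; no; does; contradiction)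
open import Relation.Nullary.Decidable using (_→-dec_; _×-dec_; ¬?; dec-true)

𝟙 : Bool → ℕ
𝟙 b = if b then 1 else 0

∑-mono-≤ : ∀ {n} {f g : Fin n → ℕ} → (∀ i → f i ≤ g i) → sum f ≤ sum g
∑-mono-≤ {zero}  _   = z≤n
∑-mono-≤ {suc n} f≤g = +-mono-≤ (f≤g zero) (∑-mono-≤ (f≤g ∘ suc))

term≤∑ : ∀ {n} (f : Fin n → ℕ) i → f i ≤ sum f
term≤∑ f zero    = m≤m+n _ _
term≤∑ f (suc i) = ≤-trans (term≤∑ (f ∘ suc) i) (m≤n+m _ _)

pair≤∑ : ∀ {n} (f : Fin n → ℕ) {i j} → i ≢ j → f i + f j ≤ sum f
pair≤∑ f {zero}  {zero}  0≢0 = contradiction refl 0≢0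
pair≤∑ f {zero}  {suc j} _   = +-monoʳ-≤ (f zero) (term≤∑ (f ∘ suc) j)
pair≤∑ f {suc i} {zero}  _   = subst (_≤ sum f) (+-comm (f zero) _) (+-monoʳ-≤ (f zero) (term≤∑ (f ∘ suc) i))
pair≤∑ f {suc i} {suc j} i≢j = ≤-trans (pair≤∑ (f ∘ suc) (i≢j ∘ cong suc)) (m≤n+m _ _)

∑∑-distrib-+ : ∀ {m n} (f g : Fin m → Fin n → ℕ) →
               ∑[ u < m ] ∑[ v < n ] (f u v + g u v) ≡ ∑[ u < m ] ∑[ v < n ] f u v + ∑[ u < m ] ∑[ v < n ] g u v
∑∑-distrib-+ f g = trans (sum-cong-≗ (λ u → ∑-distrib-+ (f u) (g u)))
                         (∑-distrib-+ (λ u → ∑[ v < _ ] f u v) (λ u → ∑[ v < _ ] g u v))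

∑-𝟙-≟ : ∀ {n} (i : Fin n) → ∑[ j < n ] 𝟙 (does (i ≟ j)) ≡ 1
∑-𝟙-≟ {suc n} zero    = cong suc (sum-replicate-zero n)
∑-𝟙-≟ {suc n} (suc i) = ∑-𝟙-≟ i

∑-𝟙-∧-≟ : ∀ {n} a (i : Fin n) → ∑[ j < n ] 𝟙 (a ∧ does (i ≟ j)) ≡ 𝟙 a
∑-𝟙-∧-≟     true  i = ∑-𝟙-≟ i
∑-𝟙-∧-≟ {n} false _ = sum-replicate-zero n

pigeonhole : ∀ {k} c (N : Fin k → ℕ) → sum N < k * suc c → ∃ λ j → N j ≤ c
pigeonhole {suc k} c N ∑N< with N zero ≤? c
... | yes N₀≤c = zero , N₀≤c
... | no  N₀≰c = Product.map suc id (pigeonhole c (N ∘ suc)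
                   (+-cancelˡ-< (suc c) _ _ (≤-<-trans (+-monoˡ-≤ _ (≰⇒> N₀≰c)) ∑N<)))

sum-map-tabulate : ∀ {n} {A : Set} (h : A → ℕ) (g : Fin n → A) →
                   ListAction.sum (map h (tabulate g)) ≡ ∑[ i < n ] h (g i)
sum-map-tabulate {zero}  h g = refl
sum-map-tabulate {suc n} h g = cong (h (g zero) +_) (sum-map-tabulate h (g ∘ suc))

count≡∑ : ∀ {n} (p : Fin n → Bool) → count p ≡ ∑[ u < n ] 𝟙 (p u)
count≡∑ p = sum-map-tabulate (𝟙 ∘ p) id

count≤1⇒unique : ∀ {n} (p : Fin n → Bool) → count p ≤ 1 → ∀ {a b} → p a ≡ true → p b ≡ true → a ≡ b
count≤1⇒unique p count≤1 {a} {b} pa pb with a ≟ b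
... | yes a≡b = a≡b
... | no  a≢b = contradiction (begin
      2                    ≡⟨ cong₂ (λ x y → 𝟙 x + 𝟙 y) pa pb ⟨
      𝟙 (p a) + 𝟙 (p b)    ≤⟨ pair≤∑ (𝟙 ∘ p) a≢b ⟩
      ∑[ u < _ ] 𝟙 (p u)   ≡⟨ count≡∑ p ⟨
      count p              ≤⟨ count≤1 ⟩
      1                    ∎) λ { (s≤s ()) }
  where open ≤-Reasoning

edgeCount≡∑ : ∀ {n} {G : Graph n} (F : EdgeSet G) →
              edgeCount F ≡ ∑[ u < n ] ∑[ v < n ] 𝟙 ((toℕ u <ᵇ toℕ v) ∧ mem F u v)
edgeCount≡∑ F = trans (sum-map-tabulate (λ u → count (λ v → (toℕ u <ᵇ toℕ v) ∧ mem F u v)) id)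
                      (sum-cong-≗ (λ u → count≡∑ (λ v → (toℕ u <ᵇ toℕ v) ∧ mem F u v)))

∣p∣≡∑ : ∀ {n} (p : Subset n) → ∣ p ∣ ≡ ∑[ u < n ] 𝟙 (lookup p u)
∣p∣≡∑ []          = refl
∣p∣≡∑ (true  ∷ p) = cong suc (∣p∣≡∑ p)
∣p∣≡∑ (false ∷ p) = ∣p∣≡∑ p

∣tabulate∣≡∑ : ∀ {n} (b : Fin n → Bool) → ∣ Vec.tabulate b ∣ ≡ ∑[ u < n ] 𝟙 (b u)
∣tabulate∣≡∑ b = trans (∣p∣≡∑ (Vec.tabulate b)) (sum-cong-≗ (cong 𝟙 ∘ lookup∘tabulate b))

term≤foldr-⊔ : ∀ {n} {A : Set} (h : A → ℕ) (g : Fin n → A) i → h (g i) ≤ foldr _⊔_ 0 (map h (tabulate g))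
term≤foldr-⊔ h g zero    = m≤m⊔n _ _
term≤foldr-⊔ h g (suc i) = ≤-trans (term≤foldr-⊔ h (g ∘ suc) i) (m≤n⊔m (h (g zero)) _)

degree≤maxDegree : ∀ {n} (G : Graph n) v → degree G v ≤ maxDegree G
degree≤maxDegree G = term≤foldr-⊔ (degree G) id

𝟙-mono : ∀ {a b} → (a ≡ true → b ≡ true) → 𝟙 a ≤ 𝟙 b
𝟙-mono {false} _   = z≤n
𝟙-mono {true}  a⇒b rewrite a⇒b refl = ≤-refl

𝟙[0<ᵇ]≤ : ∀ m → 𝟙 (0 <ᵇ m) ≤ m
𝟙[0<ᵇ]≤ zero    = z≤n
𝟙[0<ᵇ]≤ (suc m) = s≤s z≤n

𝟙-∧-split : ∀ a {b c d} → (b ≡ true → c ≡ true ⊎ d ≡ true) → 𝟙 (a ∧ b) ≤ 𝟙 (a ∧ c) + 𝟙 (a ∧ d)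
𝟙-∧-split false                       _     = z≤n
𝟙-∧-split true {false}                _     = z≤n
𝟙-∧-split true {true} {true}          _     = s≤s z≤n
𝟙-∧-split true {true} {false} {true}  _     = s≤s z≤n
𝟙-∧-split true {true} {false} {false} b⇒c∨d = [ (λ ()) , (λ ()) ] (b⇒c∨d refl)

𝟙-<ᵇ-asym : ∀ x y r → 𝟙 ((x <ᵇ y) ∧ r) + 𝟙 ((y <ᵇ x) ∧ r) ≤ 𝟙 r
𝟙-<ᵇ-asym x y r with x <ᵇ y in x<y | y <ᵇ x in y<x
... | false | false = z≤n
... | false | true  = ≤-refl
... | true  | false = ≤-reflexive (+-identityʳ (𝟙 r))
... | true  | true  = contradiction (<ᵇ⇒< y x (Equivalence.from T-≡ y<x)) (<-asym (<ᵇ⇒< x y (Equivalence.from T-≡ x<y)))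

∧-≡true⁻ : ∀ {a b} → a ∧ b ≡ true → a ≡ true × b ≡ true
∧-≡true⁻ {true} {true} _ = refl , refl

∧-monoʳ-≡true : ∀ a {b c} → (b ≡ true → c ≡ true) → a ∧ b ≡ true → a ∧ c ≡ true
∧-monoʳ-≡true true  b⇒c = b⇒c
∧-monoʳ-≡true false _   = λ ()

∨-≡true⁻ : ∀ {a b} → a ∨ b ≡ true → a ≡ true ⊎ b ≡ true
∨-≡true⁻ {true}  _ = inj₁ refl
∨-≡true⁻ {false} b = inj₂ b

∨-≡true⁺ : ∀ {a b} → a ≡ true ⊎ b ≡ true → a ∨ b ≡ true
∨-≡true⁺ {true}  _        = refl
∨-≡true⁺ {false} (inj₂ b) = b

contraposeᵇ : ∀ {a b} → (a ≡ true → b ≡ true) → b ≡ false → a ≡ false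
contraposeᵇ {false} _   _   = refl
contraposeᵇ {true}  a⇒b b≡f = contradiction (trans (sym (a⇒b refl)) b≡f) λ ()

record Induced {n} (G : Graph n) (W : Subset n) (u v : Fin n) : Set where
  constructor induced
  field
    head∈ : u ∈ W
    tail∈ : v ∈ W
    edge  : adj G u v ≡ true

Touches : ∀ {n} → ℕ → Fin n → Fin n → Set
Touches i u v = toℕ u ≡ i ⊎ toℕ v ≡ i

ProperOn : ∀ {n k} → Graph n → Subset n → (Fin n → Fin k) → Set
ProperOn G W c = ∀ u v → u ∈ W → v ∈ W → adj G u v ≡ true → c u ≢ c v

adj⇒≢ : ∀ {n} (G : Graph n) {u v} → adj G u v ≡ true → u ≢ v
adj⇒≢ G uv refl = contradiction (trans (sym uv) (irrefl G _)) λ ()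

module _ {n : ℕ} where

  colorable-mono : ∀ {G G′ : Graph n} {W W′ k} → (∀ {u v} → Induced G′ W′ u v → Induced G W u v) →
                   Colorable G W k → Colorable G′ W′ k
  colorable-mono sub (c , proper) = c , λ u v u∈W′ v∈W′ uv →
    let induced u∈W v∈W uv′ = sub (induced u∈W′ v∈W′ uv) in proper u v u∈W v∈W uv′

  colorable-≤ : ∀ {G : Graph n} {W k k′} → k ≤ k′ → Colorable G W k → Colorable G W k′
  colorable-≤ k≤k′ (c , proper) = (λ u → inject≤ (c u) k≤k′) , λ u v u∈W v∈W uv eq →
    proper u v u∈W v∈W uv (inject≤-injective k≤k′ k≤k′ (c u) (c v) eq)

  proper? : ∀ {k} G W (c : Fin n → Fin k) → Dec (ProperOn G W c)
  proper? G W c = all? λ u → all? λ v →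
    u ∈? W →-dec v ∈? W →-dec adj G u v Bool.≟ true →-dec ¬? (c u ≟ c v)

  colorable? : ∀ {k} G W → Dec (Colorable G W k)
  colorable? {k} G W with any? (λ (i : Fin (k ^ n)) → proper? G W (finToFun i))
  ... | yes (i , proper) = yes (finToFun i , proper)
  ... | no  none         = no λ (c , proper) → none (funToFin c , λ u v u∈W v∈W uv eq →
          proper u v u∈W v∈W uv (trans (sym (finToFun-funToFin c u)) (trans eq (finToFun-funToFin c v))))

  colorable-suc-at : ∀ {G G′ : Graph n} {W W′ k} i →
                     (∀ {u v} → Induced G′ W′ u v → Induced G W u v ⊎ Touches i u v) →
                     Colorable G W k → Colorable G′ W′ (suc k)
  colorable-suc-at {G′ = G′} {k = k} i new (c , proper) = c′ , proper′
    where
    c′ : Fin n → Fin (suc k)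
    c′ u with toℕ u ℕ.≟ i
    ... | yes _ = fromℕ k
    ... | no  _ = inject₁ (c u)

    proper′ : ProperOn G′ _ c′
    proper′ u v u∈W′ v∈W′ uv with toℕ u ℕ.≟ i | toℕ v ℕ.≟ i
    ... | yes u≡i | yes v≡i = contradiction (toℕ-injective (trans u≡i (sym v≡i))) (adj⇒≢ G′ uv)
    ... | yes _   | no  _   = fromℕ≢inject₁
    ... | no  _   | yes _   = fromℕ≢inject₁ ∘ sym
    ... | no  u≢i | no  v≢i with new (induced u∈W′ v∈W′ uv)
    ...   | inj₁ (induced u∈W v∈W uv′) = proper u v u∈W v∈W uv′ ∘ inject₁-injective
    ...   | inj₂ (inj₁ u≡i)            = contradiction u≡i u≢i
    ...   | inj₂ (inj₂ v≡i)            = contradiction v≡i v≢i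

  chromatic-of-gap : ∀ {G : Graph n} {W k} → Colorable G W (suc k) → ¬ Colorable G W k →
                     IsChromaticNumberOn G W (suc k)
  chromatic-of-gap {G} {W} col ¬col = col , λ m col′ → ≰⇒> λ m≤k → ¬col (colorable-≤ {G} {W} m≤k col′)

  chromatic-unique : ∀ {G : Graph n} {W a b} → IsChromaticNumberOn G W a → IsChromaticNumberOn G W b → a ≡ b
  chromatic-unique (col-a , min-a) (col-b , min-b) = ≤-antisym (min-a _ col-b) (min-b _ col-a)

drop-at-χ : ∀ {n} {G H : Graph n} {W χ} → IsChromaticNumber G χ → IsChromaticNumberOn H W (χ ∸ 1) →
            ∀ k → IsChromaticNumber G k → IsChromaticNumberOn H W (k ∸ 1)
drop-at-χ {G = G} χG χH k χk rewrite chromatic-unique {G = G} χk χG = χH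

first-gap : ∀ {P Q : ℕ → Set} → (∀ i → Dec (Q i)) → (∀ i → Q i → P (suc i)) →
            P 0 → ∀ m → ¬ Q m → ∃ λ i → P i × ¬ Q i
first-gap Q? Q⇒P p₀ zero    ¬q = 0 , p₀ , ¬q
first-gap {P} {Q} Q? Q⇒P p₀ (suc m) ¬q with Q? 0
... | no  ¬q₀ = 0 , p₀ , ¬q₀
... | yes q₀  = Product.map suc id (first-gap {P ∘ suc} {Q ∘ suc} (Q? ∘ suc) (Q⇒P ∘ suc) (Q⇒P 0 q₀) m ¬q)

-- The chromatic number grows by at most one per step of the chain, so it cannot jump over suc k.
chromatic-drop-in-chain :
  ∀ {n k} (H : ℕ → Graph n) (W : ℕ → Subset n) →
  (∀ i {u v} → Induced (H (suc i)) (W (suc i)) u v → Induced (H i) (W i) u v ⊎ Touches i u v) →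
  Colorable (H 0) (W 0) (suc k) → ∀ m → ¬ Colorable (H m) (W m) k →
  ∃ λ i → IsChromaticNumberOn (H i) (W i) (suc k)
chromatic-drop-in-chain {k = k} H W new col₀ m ¬colₘ =
  let (i , col , ¬col) = first-gap {λ i → Colorable (H i) (W i) (suc k)}
                           (λ i → colorable? {k = k} (H i) (W i)) (λ i → colorable-suc-at i (new i)) col₀ m ¬colₘ
  in i , chromatic-of-gap {G = H i} {W i} col ¬col

∈tabulate⁺ : ∀ {n} (b : Fin n → Bool) {u} → T (b u) → u ∈ Vec.tabulate b
∈tabulate⁺ b {u} bu = lookup⇒[]= u _ (trans (lookup∘tabulate b u) (Equivalence.to T-≡ bu))

∈tabulate⁻ : ∀ {n} (b : Fin n → Bool) {u} → u ∈ Vec.tabulate b → T (b u)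
∈tabulate⁻ b {u} u∈ = Equivalence.from T-≡ (trans (sym (lookup∘tabulate b u)) ([]=⇒lookup u∈))

late : ∀ {n} → ℕ → Subset n
late i = Vec.tabulate λ u → i ≤ᵇ toℕ u

module _ {n : ℕ} where

  ∈late⁺ : ∀ {i} {u : Fin n} → i ≤ toℕ u → u ∈ late i
  ∈late⁺ i≤u = ∈tabulate⁺ _ (≤⇒≤ᵇ i≤u)

  ∈late⁻ : ∀ {i} {u : Fin n} → u ∈ late i → i ≤ toℕ u
  ∈late⁻ {i} {u} u∈ = ≤ᵇ⇒≤ i (toℕ u) (∈tabulate⁻ _ u∈)

  ∈late-suc : ∀ {i} {u : Fin n} → toℕ u ≢ i → u ∈ late i → u ∈ late (suc i)
  ∈late-suc u≢i u∈ = ∈late⁺ (≤∧≢⇒< (∈late⁻ u∈) (u≢i ∘ sym))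

  ∉late-n : ∀ (u : Fin n) → u ∉ late n
  ∉late-n u = <⇒≱ (toℕ<n u) ∘ ∈late⁻

  ∈∁∩late-zero : ∀ (p : Subset n) {u} → u ∈ ∁ (p ∩ late 0) → u ∈ ∁ p
  ∈∁∩late-zero p u∈ = x∉p⇒x∈∁p λ u∈p → x∈∁p⇒x∉p u∈ (x∈p∩q⁺ (u∈p , ∈late⁺ z≤n))

  ∈∁∩late-n : ∀ (p : Subset n) u → u ∈ ∁ (p ∩ late n)
  ∈∁∩late-n p u = x∉p⇒x∈∁p (∉late-n u ∘ proj₂ ∘ x∈p∩q⁻ p _)

  ∈∁∩late-suc : ∀ (p : Subset n) {i u} → u ∈ ∁ (p ∩ late (suc i)) →
                u ∈ ∁ (p ∩ late i) ⊎ (toℕ u ≡ i × u ∈ p)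
  ∈∁∩late-suc p {i} {u} u∈ with toℕ u ℕ.≟ i | u ∈? p
  ... | yes u≡i | yes u∈p = inj₂ (u≡i , u∈p)
  ... | yes _   | no  u∉p = inj₁ (x∉p⇒x∈∁p (u∉p ∘ proj₁ ∘ x∈p∩q⁻ p _))
  ... | no  u≢i | _       = inj₁ (x∉p⇒x∈∁p λ u∈p∩late →
          let (u∈p , u-late) = x∈p∩q⁻ p _ u∈p∩late
          in x∈∁p⇒x∉p u∈ (x∈p∩q⁺ (u∈p , ∈late-suc u≢i u-late)))

-- Deleting vertices or edges one index at a time

exact-vertex-drop : ∀ {n k} (G : Graph n) (S : Subset n) → Colorable G (∁ S) (suc k) → ¬ Colorable G ⊤ k →
                    ∃ λ S′ → ∣ S′ ∣ ≤ ∣ S ∣ × IsChromaticNumberOn G (∁ S′) (suc k)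
exact-vertex-drop {n} {k} G S col ¬col =
  let (i , χ-drop) = chromatic-drop-in-chain {k = k} (λ _ → G) (λ i → ∁ (S ∩ late i)) new
                       (colorable-mono start col) n (¬col ∘ colorable-mono end)
  in S ∩ late i , ∣p∩q∣≤∣p∣ S (late i) , χ-drop
  where
  start : ∀ {u v} → Induced G (∁ (S ∩ late 0)) u v → Induced G (∁ S) u v
  start (induced u∈ v∈ uv) = induced (∈∁∩late-zero S u∈) (∈∁∩late-zero S v∈) uv

  end : ∀ {u v} → Induced G ⊤ u v → Induced G (∁ (S ∩ late n)) u v
  end {u} {v} (induced _ _ uv) = induced (∈∁∩late-n S u) (∈∁∩late-n S v) uv

  new : ∀ i {u v} → Induced G (∁ (S ∩ late (suc i))) u v → Induced G (∁ (S ∩ late i)) u v ⊎ Touches i u v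
  new i (induced u∈ v∈ uv) with ∈∁∩late-suc S u∈ | ∈∁∩late-suc S v∈
  ... | inj₂ (u≡i , _) | _              = inj₂ (inj₁ u≡i)
  ... | inj₁ _         | inj₂ (v≡i , _) = inj₂ (inj₂ v≡i)
  ... | inj₁ u∈′       | inj₁ v∈′       = inj₁ (induced u∈′ v∈′ uv)

module _ {n : ℕ} {G : Graph n} where

  adj-deleteEdges⁻ : ∀ (F : EdgeSet G) {u v} → adj (deleteEdges G F) u v ≡ true →
                     adj G u v ≡ true × mem F u v ≡ false
  adj-deleteEdges⁻ F {u} {v} uv with adj G u v | mem F u v
  ... | true | false = refl , refl

  adj-deleteEdges⁺ : ∀ (F : EdgeSet G) {u v} → adj G u v ≡ true → mem F u v ≡ false →
                     adj (deleteEdges G F) u v ≡ true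
  adj-deleteEdges⁺ F uv uv∉F rewrite uv | uv∉F = refl

  deleteEdges-antitone : ∀ (F F′ : EdgeSet G) {u v} → (mem F u v ≡ true → mem F′ u v ≡ true) →
                         adj (deleteEdges G F′) u v ≡ true → adj (deleteEdges G F) u v ≡ true
  deleteEdges-antitone F F′ F⊆F′ uv′ =
    let (uv , uv∉F′) = adj-deleteEdges⁻ F′ uv′ in adj-deleteEdges⁺ F uv (contraposeᵇ F⊆F′ uv∉F′)

  edgeCount-mono : ∀ (F F′ : EdgeSet G) → (∀ {u v} → mem F u v ≡ true → mem F′ u v ≡ true) →
                   edgeCount F ≤ edgeCount F′
  edgeCount-mono F F′ F⊆F′ = begin
    edgeCount F                                                ≡⟨ edgeCount≡∑ F ⟩
    ∑[ u < n ] ∑[ v < n ] 𝟙 ((toℕ u <ᵇ toℕ v) ∧ mem F u v)    ≤⟨ ∑-mono-≤ (λ u → ∑-mono-≤ λ v →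
                                                                    𝟙-mono (∧-monoʳ-≡true (toℕ u <ᵇ toℕ v) (F⊆F′ {u} {v}))) ⟩
    ∑[ u < n ] ∑[ v < n ] 𝟙 ((toℕ u <ᵇ toℕ v) ∧ mem F′ u v)   ≡⟨ edgeCount≡∑ F′ ⟨
    edgeCount F′                                               ∎
    where open ≤-Reasoning

  restrictEdges : EdgeSet G → Subset n → EdgeSet G
  restrictEdges F p = record
    { mem    = λ u v → (lookup p u ∧ lookup p v) ∧ mem F u v
    ; memSym = λ u v → cong₂ _∧_ (∧-comm (lookup p u) (lookup p v)) (memSym F u v)
    ; sub    = λ u v uv∈ → sub F u v (proj₂ (∧-≡true⁻ uv∈))
    }

  mem-restrict⁻ : ∀ F p {u v} → mem (restrictEdges F p) u v ≡ true → u ∈ p × v ∈ p × mem F u v ≡ true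
  mem-restrict⁻ F p {u} {v} uv∈ =
    let (uv∈p , uv∈F) = ∧-≡true⁻ uv∈ ; (u∈p , v∈p) = ∧-≡true⁻ uv∈p
    in lookup⇒[]= u p u∈p , lookup⇒[]= v p v∈p , uv∈F

  mem-restrict⁺ : ∀ F p {u v} → u ∈ p → v ∈ p → mem F u v ≡ true → mem (restrictEdges F p) u v ≡ true
  mem-restrict⁺ F p u∈p v∈p uv∈F = cong₂ _∧_ (cong₂ _∧_ ([]=⇒lookup u∈p) ([]=⇒lookup v∈p)) uv∈F

  exact-edge-drop : ∀ {k} (F : EdgeSet G) → Colorable (deleteEdges G F) ⊤ (suc k) → ¬ Colorable G ⊤ k →
                    ∃ λ F′ → edgeCount F′ ≤ edgeCount F × IsChromaticNumber (deleteEdges G F′) (suc k)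
  exact-edge-drop {k} F col ¬col =
    let (i , χ-drop) = chromatic-drop-in-chain {k = k}
                         (λ i → deleteEdges G (restrictEdges F (late i))) (λ _ → ⊤) new
                         (colorable-mono start col) n (¬col ∘ colorable-mono end)
    in restrictEdges F (late i)
     , edgeCount-mono (restrictEdges F (late i)) F (proj₂ ∘ proj₂ ∘ mem-restrict⁻ F (late i))
     , χ-drop
    where
    start : ∀ {u v} → Induced (deleteEdges G (restrictEdges F (late 0))) ⊤ u v → Induced (deleteEdges G F) ⊤ u v
    start (induced _ _ uv) = induced ∈⊤ ∈⊤ (deleteEdges-antitone F (restrictEdges F (late 0))
      (mem-restrict⁺ F (late 0) (∈late⁺ z≤n) (∈late⁺ z≤n)) uv)

    end : ∀ {u v} → Induced G ⊤ u v → Induced (deleteEdges G (restrictEdges F (late n))) ⊤ u v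
    end {u} (induced _ _ uv) = induced ∈⊤ ∈⊤ (adj-deleteEdges⁺ (restrictEdges F (late n)) uv
      (¬-not (∉late-n u ∘ proj₁ ∘ mem-restrict⁻ F (late n))))

    new : ∀ i {u v} → Induced (deleteEdges G (restrictEdges F (late (suc i)))) ⊤ u v →
          Induced (deleteEdges G (restrictEdges F (late i))) ⊤ u v ⊎ Touches i u v
    new i {u} {v} (induced _ _ uv) with toℕ u ℕ.≟ i | toℕ v ℕ.≟ i
    ... | yes u≡i | _       = inj₂ (inj₁ u≡i)
    ... | no  _   | yes v≡i = inj₂ (inj₂ v≡i)
    ... | no  u≢i | no  v≢i =
      inj₁ (induced ∈⊤ ∈⊤ (deleteEdges-antitone (restrictEdges F (late i)) (restrictEdges F (late (suc i))) later uv))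
      where
      later : mem (restrictEdges F (late i)) u v ≡ true → mem (restrictEdges F (late (suc i))) u v ≡ true
      later uv∈ = let (u∈ , v∈ , uv∈F) = mem-restrict⁻ F (late i) uv∈
                  in mem-restrict⁺ F (late (suc i)) (∈late-suc u≢i u∈) (∈late-suc v≢i v∈) uv∈F

-- From edge deletion to vertex deletion

module _ {n : ℕ} {G : Graph n} (F : EdgeSet G) where

  upperDegree : Fin n → ℕ
  upperDegree u = count λ v → (toℕ u <ᵇ toℕ v) ∧ mem F u v

  lowerEnds : Subset n
  lowerEnds = Vec.tabulate λ u → 0 <ᵇ upperDegree u

  ∣lowerEnds∣≤edgeCount : ∣ lowerEnds ∣ ≤ edgeCount F
  ∣lowerEnds∣≤edgeCount = begin
    ∣ lowerEnds ∣                        ≡⟨ ∣tabulate∣≡∑ (λ u → 0 <ᵇ upperDegree u) ⟩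
    ∑[ u < n ] 𝟙 (0 <ᵇ upperDegree u)   ≤⟨ ∑-mono-≤ (𝟙[0<ᵇ]≤ ∘ upperDegree) ⟩
    ∑[ u < n ] upperDegree u             ≡⟨ sum-map-tabulate upperDegree id ⟨
    edgeCount F                          ∎
    where open ≤-Reasoning

  ∈lowerEnds : ∀ {u v} → toℕ u < toℕ v → mem F u v ≡ true → u ∈ lowerEnds
  ∈lowerEnds {u} {v} u<v uv∈F = ∈tabulate⁺ _ (<⇒<ᵇ (begin
    1                                                ≡⟨ cong 𝟙 counted ⟨
    𝟙 ((toℕ u <ᵇ toℕ v) ∧ mem F u v)                 ≤⟨ term≤∑ (λ w → 𝟙 ((toℕ u <ᵇ toℕ w) ∧ mem F u w)) v ⟩
    ∑[ w < n ] 𝟙 ((toℕ u <ᵇ toℕ w) ∧ mem F u w)     ≡⟨ count≡∑ (λ w → (toℕ u <ᵇ toℕ w) ∧ mem F u w) ⟨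
    upperDegree u                                    ∎))
    where
    open ≤-Reasoning
    counted : (toℕ u <ᵇ toℕ v) ∧ mem F u v ≡ true
    counted = cong₂ _∧_ (Equivalence.to T-≡ (<⇒<ᵇ u<v)) uv∈F

  lowerEnds-cover : ∀ {u v} → mem F u v ≡ true → u ∈ lowerEnds ⊎ v ∈ lowerEnds
  lowerEnds-cover {u} {v} uv∈F with <-cmp (toℕ u) (toℕ v)
  ... | tri< u<v _   _   = inj₁ (∈lowerEnds u<v uv∈F)
  ... | tri≈ _   u≡v _   = contradiction (toℕ-injective u≡v) (adj⇒≢ G (sub F u v uv∈F))
  ... | tri> _   _   v<u = inj₂ (∈lowerEnds v<u (trans (memSym F v u) uv∈F))

  vertex-drop-from-edge-deletion : ∀ {k} → Colorable (deleteEdges G F) ⊤ (suc k) → ¬ Colorable G ⊤ k →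
                                   ∃ λ S → ∣ S ∣ ≤ edgeCount F × IsChromaticNumberOn G (∁ S) (suc k)
  vertex-drop-from-edge-deletion col ¬col =
    let (S , S≤lowerEnds , χ-drop) = exact-vertex-drop G lowerEnds (colorable-mono avoid col) ¬col
    in S , ≤-trans S≤lowerEnds ∣lowerEnds∣≤edgeCount , χ-drop
    where
    avoid : ∀ {u v} → Induced G (∁ lowerEnds) u v → Induced (deleteEdges G F) ⊤ u v
    avoid (induced u∈ v∈ uv) = induced ∈⊤ ∈⊤ (adj-deleteEdges⁺ F uv (¬-not λ uv∈F →
      [ x∈∁p⇒x∉p u∈ , x∈∁p⇒x∉p v∈ ] (lowerEnds-cover uv∈F)))

-- From vertex deletion to edge deletion

pointsTo : ∀ {n} → Maybe (Fin n) → Fin n → Bool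
pointsTo nothing  _ = false
pointsTo (just w) v = does (w ≟ v)

module _ {n : ℕ} where

  pointsTo⁻ : ∀ (m : Maybe (Fin n)) {v} → pointsTo m v ≡ true → m ≡ just v
  pointsTo⁻ (just w) {v} e with w ≟ v
  ... | yes refl = refl
  ... | no  _    = contradiction e λ ()

  pointsTo⁺ : ∀ {m : Maybe (Fin n)} {v} → m ≡ just v → pointsTo m v ≡ true
  pointsTo⁺ {v = v} refl = dec-true (v ≟ v) refl

  ∑-pointsTo : ∀ (m : Maybe (Fin n)) → ∑[ v < n ] 𝟙 (pointsTo m v) ≡ 𝟙 (is-just m)
  ∑-pointsTo nothing  = sum-replicate-zero n
  ∑-pointsTo (just w) = ∑-𝟙-≟ w

  count≤1-witness : ∀ (p : Fin n → Bool) → count p ≤ 1 →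
                    ∃ λ (m : Maybe (Fin n)) →
                      (∀ {w} → m ≡ just w → p w ≡ true) × (∀ {v} → p v ≡ true → m ≡ just v)
  count≤1-witness p count≤1 with any? (λ v → p v Bool.≟ true)
  ... | yes (w , pw) = just w , (λ { refl → pw }) , λ pv → cong just (count≤1⇒unique p count≤1 pw pv)
  ... | no  none     = nothing , (λ ()) , λ {v} pv → contradiction (v , pv) none

module _ {n : ℕ} {G : Graph n} where

  orientation-bound : ∀ (F : EdgeSet G) (R : Fin n → Fin n → Bool) →
                      (∀ {u v} → mem F u v ≡ true → R u v ≡ true ⊎ R v u ≡ true) →
                      edgeCount F ≤ ∑[ u < n ] ∑[ v < n ] 𝟙 (R u v)
  orientation-bound F R oriented = begin
    edgeCount F                                               ≡⟨ edgeCount≡∑ F ⟩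
    ∑[ u < n ] ∑[ v < n ] 𝟙 ((toℕ u <ᵇ toℕ v) ∧ mem F u v)   ≤⟨ ∑-mono-≤ (λ u → ∑-mono-≤ λ v →
                                                                   𝟙-∧-split (toℕ u <ᵇ toℕ v) (oriented {u} {v})) ⟩
    ∑[ u < n ] ∑[ v < n ] (X u v + Y v u)                    ≡⟨ ∑∑-distrib-+ X (λ u v → Y v u) ⟩
    ∑∑ X + ∑[ u < n ] ∑[ v < n ] Y v u                       ≡⟨ cong (∑∑ X +_) (∑-comm (λ u v → Y v u)) ⟩
    ∑∑ X + ∑∑ Y                                               ≡⟨ ∑∑-distrib-+ X Y ⟨
    ∑[ u < n ] ∑[ v < n ] (X u v + Y u v)                    ≤⟨ ∑-mono-≤ (λ u → ∑-mono-≤ λ v →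
                                                                   𝟙-<ᵇ-asym (toℕ u) (toℕ v) (R u v)) ⟩
    ∑[ u < n ] ∑[ v < n ] 𝟙 (R u v)                           ∎
    where
    open ≤-Reasoning
    X Y : Fin n → Fin n → ℕ
    X u v = 𝟙 ((toℕ u <ᵇ toℕ v) ∧ R u v)
    Y u v = 𝟙 ((toℕ v <ᵇ toℕ u) ∧ R u v)
    ∑∑ : (Fin n → Fin n → ℕ) → ℕ
    ∑∑ f = ∑[ u < n ] ∑[ v < n ] f u v

module _ {n : ℕ} {G : Graph n} {k : ℕ} where

  coloredNeighbour : (Fin n → Fin k) → Fin n → Fin k → Fin n → Bool
  coloredNeighbour c x j v = adj G x v ∧ does (c v ≟ j)

  ∑-count-coloredNeighbour : ∀ c x → ∑[ j < k ] count (coloredNeighbour c x j) ≡ degree G x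
  ∑-count-coloredNeighbour c x = begin
    ∑[ j < k ] count (coloredNeighbour c x j)                 ≡⟨ sum-cong-≗ (count≡∑ ∘ coloredNeighbour c x) ⟩
    ∑[ j < k ] ∑[ v < n ] 𝟙 (adj G x v ∧ does (c v ≟ j))      ≡⟨ ∑-comm (λ j v → 𝟙 (adj G x v ∧ does (c v ≟ j))) ⟩
    ∑[ v < n ] ∑[ j < k ] 𝟙 (adj G x v ∧ does (c v ≟ j))      ≡⟨ sum-cong-≗ (λ v → ∑-𝟙-∧-≟ (adj G x v) (c v)) ⟩
    ∑[ v < n ] 𝟙 (adj G x v)                                   ≡⟨ count≡∑ (adj G x) ⟨
    degree G x                                                 ∎
    where open ≡-Reasoning

  rare-color : ∀ c x → degree G x < k * 2 →
               ∃ λ j → ∃ λ (m : Maybe (Fin n)) →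
                 (∀ {w} → m ≡ just w → adj G x w ≡ true) × (∀ {v} → adj G x v ≡ true → c v ≡ j → m ≡ just v)
  rare-color c x deg< =
    let (j , rare) = pigeonhole 1 (count ∘ coloredNeighbour c x)
                       (subst (_< k * 2) (sym (∑-count-coloredNeighbour c x)) deg<)
        (m , m-colored , m-unique) = count≤1-witness (coloredNeighbour c x j) rare
    in j , m , proj₁ ∘ ∧-≡true⁻ ∘ m-colored , λ {v} xv cv≡j →
         m-unique (cong₂ _∧_ xv (dec-true (c v ≟ j) cv≡j))

-- A coloring of G that is proper on the placed vertices except along the edges
-- {u, partner u}; only vertices of S have a partner, so there are at most ∣ S ∣ such edges.
record NearColoring {n} (G : Graph n) (S : Subset n) (k : ℕ) (Placed : Fin n → Set) : Set where
  field
    color       : Fin n → Fin k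
    partner     : Fin n → Maybe (Fin n)
    partner-adj : ∀ {u w} → partner u ≡ just w → adj G u w ≡ true
    partner-∈   : ∀ {u w} → partner u ≡ just w → u ∈ S
    clash       : ∀ {u v} → Placed u → Placed v → adj G u v ≡ true → color u ≡ color v →
                  partner u ≡ just v ⊎ partner v ≡ just u
open NearColoring

module _ {n : ℕ} {G : Graph n} {S : Subset n} {k : ℕ} where

  fromColorable : Colorable G (∁ S) k → NearColoring G S k (_∈ ∁ S)
  fromColorable (c , proper) = record
    { color       = c
    ; partner     = λ _ → nothing
    ; partner-adj = λ ()
    ; partner-∈   = λ ()
    ; clash       = λ u∈ v∈ uv eq → contradiction eq (proper _ _ u∈ v∈ uv)
    }

  shrink : ∀ {P P′ : Fin n → Set} → (∀ {u} → P′ u → P u) → NearColoring G S k P → NearColoring G S k P′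
  shrink P′⊆P nc = record
    { color       = color nc
    ; partner     = partner nc
    ; partner-adj = partner-adj nc
    ; partner-∈   = partner-∈ nc
    ; clash       = λ u∈ v∈ → clash nc (P′⊆P u∈) (P′⊆P v∈)
    }

  extend : ∀ {P} → NearColoring G S k P → ∀ x → x ∈ S → degree G x < k * 2 →
           NearColoring G S k (λ u → P u ⊎ u ≡ x)
  extend {P} nc x x∈S deg< with rare-color {G = G} (color nc) x deg<
  ... | j , m , m-adj , m-unique = record
    { color       = color′
    ; partner     = partner′
    ; partner-adj = partner-adj′
    ; partner-∈   = partner-∈′
    ; clash       = clash′
    }
    where
    color′ : Fin n → Fin k
    color′ u with u ≟ x
    ... | yes _ = j
    ... | no  _ = color nc u

    partner′ : Fin n → Maybe (Fin n)
    partner′ u with u ≟ x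
    ... | yes _ = m
    ... | no  _ = partner nc u

    partner-adj′ : ∀ {u w} → partner′ u ≡ just w → adj G u w ≡ true
    partner-adj′ {u} with u ≟ x
    ... | yes refl = m-adj
    ... | no  _    = partner-adj nc

    partner-∈′ : ∀ {u w} → partner′ u ≡ just w → u ∈ S
    partner-∈′ {u} with u ≟ x
    ... | yes refl = λ _ → x∈S
    ... | no  _    = partner-∈ nc

    placed-before : ∀ {u} → P u ⊎ u ≡ x → u ≢ x → P u
    placed-before (inj₁ pu)  _   = pu
    placed-before (inj₂ u≡x) u≢x = contradiction u≡x u≢x

    clash′ : ∀ {u v} → P u ⊎ u ≡ x → P v ⊎ v ≡ x → adj G u v ≡ true → color′ u ≡ color′ v →
             partner′ u ≡ just v ⊎ partner′ v ≡ just u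
    clash′ {u} {v} pu pv uv with u ≟ x | v ≟ x
    ... | yes refl | yes refl = contradiction refl (adj⇒≢ G uv)
    ... | yes refl | no  _    = λ j≡cv → inj₁ (m-unique uv (sym j≡cv))
    ... | no  _    | yes refl = λ cu≡j → inj₂ (m-unique (trans (Graph.sym G x u) uv) cu≡j)
    ... | no  u≢x  | no  v≢x  = clash nc (placed-before pu u≢x) (placed-before pv v≢x) uv

  nearColoring : (∀ x → x ∈ S → degree G x < k * 2) → Colorable G (∁ S) k →
                 ∀ i → NearColoring G S k (_∈ ∁ (S ∩ late i))
  nearColoring deg< col zero    = shrink (∈∁∩late-zero S) (fromColorable col)
  nearColoring deg< col (suc i) with any? (λ x → toℕ x ℕ.≟ i ×-dec x ∈? S)
  ... | yes (x , x≡i , x∈S) = shrink added (extend (nearColoring deg< col i) x x∈S (deg< x x∈S))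
    where
    added : ∀ {u} → u ∈ ∁ (S ∩ late (suc i)) → u ∈ ∁ (S ∩ late i) ⊎ u ≡ x
    added u∈ = Sum.map₂ (λ (u≡i , _) → toℕ-injective (trans u≡i (sym x≡i))) (∈∁∩late-suc S u∈)
  ... | no  none = shrink unchanged (nearColoring deg< col i)
    where
    unchanged : ∀ {u} → u ∈ ∁ (S ∩ late (suc i)) → u ∈ ∁ (S ∩ late i)
    unchanged {u} u∈ = [ id , (λ (u≡i , u∈S) → contradiction (u , u≡i , u∈S) none) ] (∈∁∩late-suc S u∈)

module _ {n : ℕ} {G : Graph n} {S : Subset n} {k : ℕ} {P : Fin n → Set} (nc : NearColoring G S k P) where

  partnerEdges : EdgeSet G
  partnerEdges = record
    { mem    = λ u v → pointsTo (partner nc u) v ∨ pointsTo (partner nc v) u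
    ; memSym = λ u v → ∨-comm (pointsTo (partner nc u) v) _
    ; sub    = λ u v uv∈ → [ partner-adj nc ∘ pointsTo⁻ _
                           , (λ vu → trans (Graph.sym G u v) (partner-adj nc (pointsTo⁻ _ vu))) ] (∨-≡true⁻ uv∈)
    }

  edgeCount-partnerEdges : edgeCount partnerEdges ≤ ∣ S ∣
  edgeCount-partnerEdges = begin
    edgeCount partnerEdges
      ≤⟨ orientation-bound partnerEdges (pointsTo ∘ partner nc) ∨-≡true⁻ ⟩
    ∑[ u < n ] ∑[ v < n ] 𝟙 (pointsTo (partner nc u) v)   ≡⟨ sum-cong-≗ (∑-pointsTo ∘ partner nc) ⟩
    ∑[ u < n ] 𝟙 (is-just (partner nc u))                 ≤⟨ ∑-mono-≤ (λ u → 𝟙-mono (owner u)) ⟩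
    ∑[ u < n ] 𝟙 (lookup S u)                             ≡⟨ ∣p∣≡∑ S ⟨
    ∣ S ∣                                                 ∎
    where
    open ≤-Reasoning
    owner : ∀ u → is-just (partner nc u) ≡ true → lookup S u ≡ true
    owner u with partner nc u in u↦w
    ... | just _ = λ _ → []=⇒lookup (partner-∈ nc u↦w)

  colorable-deleting-partnerEdges : (∀ u → P u) → Colorable (deleteEdges G partnerEdges) ⊤ k
  colorable-deleting-partnerEdges placed = color nc , λ u v _ _ uv′ same →
    let (uv , uv∉F) = adj-deleteEdges⁻ partnerEdges uv′
        uv∈F = ∨-≡true⁺ (Sum.map pointsTo⁺ pointsTo⁺ (clash nc (placed u) (placed v) uv same))
    in contradiction (trans (sym uv∈F) uv∉F) λ ()

edge-deletion-from-vertex-deletion :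
  ∀ {n k} {G : Graph n} {S : Subset n} → (∀ x → x ∈ S → degree G x < k * 2) → Colorable G (∁ S) k →
  ∃ λ F → edgeCount F ≤ ∣ S ∣ × Colorable (deleteEdges G F) ⊤ k
edge-deletion-from-vertex-deletion {n} {S = S} deg< col =
  let nc = nearColoring deg< col n
  in partnerEdges nc , edgeCount-partnerEdges nc , colorable-deleting-partnerEdges nc (∈∁∩late-n S)

module _ {n : ℕ} {G : Graph n} {t : ℕ} (χG : IsChromaticNumber G (suc (suc t))) where

  ¬colorable-χ∸2 : ¬ Colorable G ⊤ t
  ¬colorable-χ∸2 col = 1+n≰n (≤-trans (n≤1+n (suc t)) (proj₂ χG t col))

  vs≤edgeCount : ∀ {vs} → IsVertexStability G vs → (F : EdgeSet G) → EdgeDeletionDrops G F → vs ≤ edgeCount F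
  vs≤edgeCount (_ , vs-min) F dropF =
    let (S , S≤F , χS) = vertex-drop-from-edge-deletion F (proj₁ (dropF _ χG)) ¬colorable-χ∸2
    in ≤-trans (vs-min S (drop-at-χ {G = G} {G} χG χS)) S≤F

  es≤∣S∣ : ∀ {es} → (∀ x → degree G x < suc t * 2) → IsEdgeStability G es →
           (S : Subset n) → VertexDeletionDrops G S → es ≤ ∣ S ∣
  es≤∣S∣ deg< (_ , es-min) S dropS =
    let (F , F≤S , colF) = edge-deletion-from-vertex-deletion (λ x _ → deg< x) (proj₁ (dropS _ χG))
        (F′ , F′≤F , χF′) = exact-edge-drop F colF ¬colorable-χ∸2
    in ≤-trans (es-min F′ (drop-at-χ {G = G} {deleteEdges G F′} χG χF′)) (≤-trans F′≤F F≤S)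

degree<[χ∸1]*2 : ∀ {n} (G : Graph n) t → maxDegree G + 2 < 2 * suc (suc t) → ∀ x → degree G x < suc t * 2
degree<[χ∸1]*2 G t Δ< x = ≤-<-trans (degree≤maxDegree G x)
  (+-cancelʳ-< 2 _ _ (subst (maxDegree G + 2 <_) (trans (*-comm 2 (suc (suc t))) (+-comm 2 (suc t * 2))) Δ<))

theorem4p1 : ∀ (n : ℕ) (G : Graph n) (χ vs es : ℕ) →
    HasEdge G →
    IsChromaticNumber G χ →
    maxDegree G + 2 < 2 * χ →
    IsVertexStability G vs →
    IsEdgeStability G es →
    vs ≡ es
theorem4p1 n G zero          vs es _ χG ()
theorem4p1 n G (suc zero)    vs es _ χG Δ< = contradiction Δ< (m+n≮n (maxDegree G) 2)
theorem4p1 n G (suc (suc t)) vs es _ χG Δ< vs-G es-G =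
  let (S , ∣S∣≡vs , dropS) = proj₁ vs-G
      (F , ∣F∣≡es , dropF) = proj₁ es-G
  in ≤-antisym (subst (vs ≤_) ∣F∣≡es (vs≤edgeCount χG vs-G F dropF))
               (subst (es ≤_) ∣S∣≡vs (es≤∣S∣ χG (degree<[χ∸1]*2 G t Δ<) es-G S dropS))
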